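{- Let $(K,+)$ be a finite abelian group and let ${\cal Z}\subsetneq K$ be a proper subset. A set ${\cal A}\subseteq K$ is ${\cal Z}$-independent if and only if, for some ordering ${\cal A}=\{\alpha_1,\dots,\alpha_t\}$ of its elements, the sequence $\alpha_1,\dots,\alpha_t$ is ${\cal Z}$-independent.
   Context: ${\cal Z}$-independent sets: defined inductively by (1) $\emptyset$ is ${\cal Z}$-independent; (2) if ${\cal A}$ is ${\cal Z}$-independent and $\psi\in K$ then $\psi+{\cal A}=\{\psi+\alpha:\alpha\in{\cal A}\}$ is ${\cal Z}$-independent; (3) if ${\cal A}\subseteq{\cal Z}$ is ${\cal Z}$-independent and $\eta\in K\setminus{\cal Z}$ then ${\cal A}\cup\{\eta\}$ is ${\cal Z}$-independent; only sets obtained by these rules are ${\cal Z}$-independent. ${\cal Z}$-independent sequences: a sequence $\alpha_1,\dots,\alpha_t$ in $K$ is ${\cal Z}$-independent if there exist $\psi_1,\dots,\psi_t\in K$ such that $\psi_1+\alpha_1\notin{\cal Z}$ and, for $2\le i\le t$, $\psi_i+\alpha_i\notin{\cal Z}$ and $\psi_i+\alpha_1,\dots,\psi_i+\alpha_{i-1}\in{\cal Z}$. (In the paper $K=\hat G$ is the character group of a finite abelian group.) -}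

module Defs where

open import Level using (0ℓ)
open import Data.Nat using (ℕ)
open import Data.Fin using (Fin; toℕ)
open import Data.Nat using (_<_)
open import Data.List using (List; length; lookup)
open import Data.List.Membership.Propositional using (_∈_)
open import Data.Product using (Σ; ∃; _×_)
open import Data.Sum using (_⊎_)
open import Relation.Nullary using (¬_)
open import Relation.Unary using (Pred; _⊆_)
open import Relation.Binary.PropositionalEquality using (_≡_)
open import Function.Bundles using (_↔_; _⇔_)

IsFinite : Set → Set
IsFinite K = Σ ℕ (λ n → K ↔ Fin n)

-- Subsets of K are predicates; sets are compared extensionally.
module ZIndependence {K : Set} (_+_ : K → K → K) (𝒵 : Pred K 0ℓ) where

  -- 𝒵-independent sets, defined inductively (rules (1)-(3));
  -- each rule yields any set extensionally equal to the one built.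
  data ZIndepSet : Pred K 0ℓ → Set₁ where
    empty : ∀ {𝒜 : Pred K 0ℓ} → (∀ x → ¬ 𝒜 x) → ZIndepSet 𝒜
    shift : ∀ {𝒜 𝒜' : Pred K 0ℓ} → ZIndepSet 𝒜 → (ψ : K) →
            (∀ x → 𝒜' x ⇔ (∃ λ a → 𝒜 a × x ≡ ψ + a)) → ZIndepSet 𝒜'
    add   : ∀ {𝒜 𝒜' : Pred K 0ℓ} → ZIndepSet 𝒜 → 𝒜 ⊆ 𝒵 → (η : K) → ¬ 𝒵 η →
            (∀ x → 𝒜' x ⇔ (𝒜 x ⊎ x ≡ η)) → ZIndepSet 𝒜'

  ZIndepSeq : List K → Set
  ZIndepSeq αs =
    Σ (Fin (length αs) → K) λ ψ →
      (∀ i → ¬ 𝒵 (ψ i + lookup αs i)) ×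
      (∀ i j → toℕ j < toℕ i → 𝒵 (ψ i + lookup αs j))

-- Read a set 𝒜 = {α₁,…,αₜ} as a sequence and call αᵢ separated from its
-- predecessors when some ψ puts ψ + αᵢ outside 𝒵 but ψ + αⱼ inside 𝒵 for j < i.
-- Rules (2) and (3) preserve "every element is separated from its predecessors"
-- (translate the witnesses by -ψ; the new element η is separated by ψ = 0 since
-- 𝒜 ⊆ 𝒵).  Conversely, if the predecessors form a 𝒵-independent set and αᵢ is
-- separated from them by ψ, then translating by ψ, adding ψ + αᵢ by rule (3) and
-- translating back by -ψ adds αᵢ to the set.
module Submission where

open import Defs
open import Level using (0ℓ)
open import Algebra.Bundles using (Group)
open import Algebra.Structures using (IsGroup; IsAbelianGroup)
import Algebra.Properties.Group as GroupProperties
open import Data.Empty using (⊥-elim)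
open import Data.Fin using (zero; suc; toℕ)
open import Data.List using (List; []; _∷_; [_]; _∷ʳ_; map; length; lookup; reverseAcc)
open import Data.List.Membership.Propositional using (_∈_)
open import Data.List.Membership.Propositional.Properties using (∈-map⁺; ∈-map⁻; ∈-++⁺ˡ; ∈-++⁺ʳ; ∈-++⁻)
open import Data.List.Relation.Unary.All as All using (All; []; _∷_)
open import Data.List.Relation.Unary.All.Properties as All using ()
open import Data.List.Relation.Unary.AllPairs using ([]; _∷_)
open import Data.List.Relation.Unary.Any using (here; there)
open import Data.List.Relation.Unary.Any.Properties using (reverse⁺; reverse⁻)
open import Data.List.Relation.Unary.Unique.Propositional using (Unique)
import Data.List.Relation.Unary.Unique.Propositional.Properties as Unique
open import Data.Nat using (_<_; z≤n; s≤s)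
open import Data.Product using (Σ; ∃; _×_; _,_)
open import Data.Sum using (_⊎_; inj₁; inj₂)
open import Data.Unit using (⊤; tt)
open import Data.Vec.Functional using (Vector) renaming (_∷_ to _◂_)
open import Function.Bundles using (_⇔_; mk⇔; Equivalence)
open import Function.Construct.Composition using (_⇔-∘_)
open import Function.Construct.Identity using (⇔-id)
open import Function.Construct.Symmetry using (⇔-sym)
open import Function.Definitions using (Injective)
open import Relation.Nullary using (¬_)
open import Relation.Unary using (Pred)
open import Relation.Binary.PropositionalEquality using (_≡_; refl; sym; trans; cong; subst)

open Equivalence using (to; from)

Enumerates : {A : Set} → Pred A 0ℓ → List A → Set
Enumerates 𝒜 αs = Unique αs × (∀ x → 𝒜 x ⇔ x ∈ αs)

module _ {A B : Set} where

  map-enumerates : ∀ {𝒜 𝒜' αs} (f : A → B) → Injective _≡_ _≡_ f → Enumerates 𝒜 αs →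
                   (∀ y → 𝒜' y ⇔ (∃ λ x → 𝒜 x × y ≡ f x)) → Enumerates 𝒜' (map f αs)
  map-enumerates {𝒜} {𝒜'} {αs} f f-inj (αs-unique , 𝒜⇔αs) 𝒜'⇔f𝒜 =
    Unique.map⁺ f-inj αs-unique , λ y → mk⇔ (⊆map y) (map⊆ y)
    where
    ⊆map : ∀ y → 𝒜' y → y ∈ map f αs
    ⊆map y y∈𝒜' with to (𝒜'⇔f𝒜 y) y∈𝒜'
    ... | x , x∈𝒜 , refl = ∈-map⁺ f (to (𝒜⇔αs x) x∈𝒜)
    map⊆ : ∀ y → y ∈ map f αs → 𝒜' y
    map⊆ y y∈fαs with ∈-map⁻ f y∈fαs
    ... | x , x∈αs , y≡fx = from (𝒜'⇔f𝒜 y) (x , from (𝒜⇔αs x) x∈αs , y≡fx)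

module _ {A : Set} where

  ∷ʳ-enumerates : ∀ {𝒜 𝒜' : Pred A 0ℓ} {αs η} → Enumerates 𝒜 αs → ¬ 𝒜 η →
                  (∀ x → 𝒜' x ⇔ (𝒜 x ⊎ x ≡ η)) → Enumerates 𝒜' (αs ∷ʳ η)
  ∷ʳ-enumerates {𝒜} {𝒜'} {αs} {η} (αs-unique , 𝒜⇔αs) η∉𝒜 𝒜'⇔𝒜+η =
    Unique.++⁺ αs-unique ([] ∷ []) η∉αs , λ x → mk⇔ (⊆∷ʳ x) (∷ʳ⊆ x)
    where
    η∉αs : ∀ {x} → ¬ (x ∈ αs × x ∈ [ η ])
    η∉αs (η∈αs , here refl) = η∉𝒜 (from (𝒜⇔αs _) η∈αs)
    ⊆∷ʳ : ∀ x → 𝒜' x → x ∈ αs ∷ʳ η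
    ⊆∷ʳ x x∈𝒜' with to (𝒜'⇔𝒜+η x) x∈𝒜'
    ... | inj₁ x∈𝒜 = ∈-++⁺ˡ (to (𝒜⇔αs x) x∈𝒜)
    ... | inj₂ refl = ∈-++⁺ʳ αs (here refl)
    ∷ʳ⊆ : ∀ x → x ∈ αs ∷ʳ η → 𝒜' x
    ∷ʳ⊆ x x∈ with ∈-++⁻ αs x∈
    ... | inj₁ x∈αs = from (𝒜'⇔𝒜+η x) (inj₁ (from (𝒜⇔αs x) x∈αs))
    ... | inj₂ (here x≡η) = from (𝒜'⇔𝒜+η x) (inj₂ x≡η)

module _ {K : Set} {_+_ : K → K → K} {0# : K} { -_ : K → K}
         (isGroup : IsGroup _≡_ _+_ 0# -_) (𝒵 : Pred K 0ℓ) where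

  open IsGroup isGroup using (assoc; identityˡ)
  group : Group 0ℓ 0ℓ
  group = record { isGroup = isGroup }

  open GroupProperties group using (∙-cancelˡ; \\-leftDividesʳ)
  open ZIndependence _+_ 𝒵

  -x+[x+y]≡y : ∀ x y → (- x) + (x + y) ≡ y
  -x+[x+y]≡y = \\-leftDividesʳ

  ZIndepSet-resp-⇔ : ∀ {𝒜 𝒜'} → ZIndepSet 𝒜 → (∀ x → 𝒜 x ⇔ 𝒜' x) → ZIndepSet 𝒜'
  ZIndepSet-resp-⇔ (empty 𝒜-empty) 𝒜⇔𝒜' = empty λ x x∈𝒜' → 𝒜-empty x (from (𝒜⇔𝒜' x) x∈𝒜')
  ZIndepSet-resp-⇔ (shift S ψ e) 𝒜⇔𝒜' = shift S ψ λ x → e x ⇔-∘ ⇔-sym (𝒜⇔𝒜' x)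
  ZIndepSet-resp-⇔ (add S S⊆𝒵 η η∉𝒵 e) 𝒜⇔𝒜' = add S S⊆𝒵 η η∉𝒵 λ x → e x ⇔-∘ ⇔-sym (𝒜⇔𝒜' x)

  Separated : List K → K → Set
  Separated pre a = ∃ λ ψ → ¬ 𝒵 (ψ + a) × All (λ b → 𝒵 (ψ + b)) pre

  -- pre lists the elements preceding αs, most recent first.
  IndepAfter : List K → List K → Set
  IndepAfter pre []       = ⊤
  IndepAfter pre (a ∷ αs) = Separated pre a × IndepAfter (a ∷ pre) αs

  ZIndepSeqAfter : List K → List K → Set
  ZIndepSeqAfter pre αs = Σ (Vector K (length αs)) λ ψ →
    (∀ i → ¬ 𝒵 (ψ i + lookup αs i)) ×
    (∀ i → All (λ b → 𝒵 (ψ i + b)) pre) ×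
    (∀ i j → toℕ j < toℕ i → 𝒵 (ψ i + lookup αs j))

  IndepAfter⇒ZIndepSeqAfter : ∀ pre αs → IndepAfter pre αs → ZIndepSeqAfter pre αs
  IndepAfter⇒ZIndepSeqAfter pre [] _ = (λ ()) , (λ ()) , (λ ()) , (λ ())
  IndepAfter⇒ZIndepSeqAfter pre (a ∷ αs) ((φ , φa∉𝒵 , φpre∈𝒵) , αs-indep)
    with IndepAfter⇒ZIndepSeqAfter (a ∷ pre) αs αs-indep
  ... | ψ , ψα∉𝒵 , ψpre∈𝒵 , ψearlier∈𝒵 = (φ ◂ ψ) , outside , prefix , earlier
    where
    outside : ∀ i → ¬ 𝒵 ((φ ◂ ψ) i + lookup (a ∷ αs) i)
    outside zero    = φa∉𝒵
    outside (suc i) = ψα∉𝒵 i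
    prefix : ∀ i → All (λ b → 𝒵 ((φ ◂ ψ) i + b)) pre
    prefix zero    = φpre∈𝒵
    prefix (suc i) = All.tail (ψpre∈𝒵 i)
    earlier : ∀ i j → toℕ j < toℕ i → 𝒵 ((φ ◂ ψ) i + lookup (a ∷ αs) j)
    earlier (suc i) zero    _         = All.head (ψpre∈𝒵 i)
    earlier (suc i) (suc j) (s≤s j<i) = ψearlier∈𝒵 i j j<i

  ZIndepSeqAfter⇒IndepAfter : ∀ pre αs → ZIndepSeqAfter pre αs → IndepAfter pre αs
  ZIndepSeqAfter⇒IndepAfter pre []       _ = tt
  ZIndepSeqAfter⇒IndepAfter pre (a ∷ αs) (ψ , ψα∉𝒵 , ψpre∈𝒵 , ψearlier∈𝒵) =
    (ψ zero , ψα∉𝒵 zero , ψpre∈𝒵 zero) ,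
    ZIndepSeqAfter⇒IndepAfter (a ∷ pre) αs
      ( (λ i → ψ (suc i)) , (λ i → ψα∉𝒵 (suc i))
      , (λ i → ψearlier∈𝒵 (suc i) zero (s≤s z≤n) ∷ ψpre∈𝒵 (suc i))
      , (λ i j j<i → ψearlier∈𝒵 (suc i) (suc j) (s≤s j<i)))

  ZIndepSeq⇔IndepAfter[] : ∀ αs → ZIndepSeq αs ⇔ IndepAfter [] αs
  ZIndepSeq⇔IndepAfter[] αs = mk⇔
    (λ (ψ , ψα∉𝒵 , ψearlier∈𝒵) →
       ZIndepSeqAfter⇒IndepAfter [] αs (ψ , ψα∉𝒵 , (λ _ → []) , ψearlier∈𝒵))
    (λ αs-indep → let ψ , ψα∉𝒵 , _ , ψearlier∈𝒵 = IndepAfter⇒ZIndepSeqAfter [] αs αs-indep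
                  in ψ , ψα∉𝒵 , ψearlier∈𝒵)

  separated-shift : ∀ s {pre a} → Separated pre a → Separated (map (s +_) pre) (s + a)
  separated-shift s {pre} {a} (ψ , ψa∉𝒵 , ψpre∈𝒵) =
    ψ + (- s) , subst (λ z → ¬ 𝒵 z) (sym (shifted a)) ψa∉𝒵 ,
    All.map⁺ (All.map (λ {b} → subst 𝒵 (sym (shifted b))) ψpre∈𝒵)
    where
    shifted : ∀ b → (ψ + (- s)) + (s + b) ≡ ψ + b
    shifted b = trans (assoc ψ (- s) (s + b)) (cong (ψ +_) (-x+[x+y]≡y s b))

  IndepAfter-shift : ∀ s pre αs → IndepAfter pre αs → IndepAfter (map (s +_) pre) (map (s +_) αs)
  IndepAfter-shift s pre []       _                   = tt
  IndepAfter-shift s pre (a ∷ αs) (a-sep , αs-indep) =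
    separated-shift s a-sep , IndepAfter-shift s (a ∷ pre) αs αs-indep

  separated-from-𝒵 : ∀ {pre η} → All 𝒵 pre → ¬ 𝒵 η → Separated pre η
  separated-from-𝒵 pre⊆𝒵 η∉𝒵 =
    0# , subst (λ z → ¬ 𝒵 z) (sym (identityˡ _)) η∉𝒵 ,
    All.map (λ {b} → subst 𝒵 (sym (identityˡ b))) pre⊆𝒵

  IndepAfter-∷ʳ : ∀ pre αs {η} → All 𝒵 pre → All 𝒵 αs → ¬ 𝒵 η →
                  IndepAfter pre αs → IndepAfter pre (αs ∷ʳ η)
  IndepAfter-∷ʳ pre []       pre⊆𝒵 []            η∉𝒵 tt = separated-from-𝒵 pre⊆𝒵 η∉𝒵 , tt
  IndepAfter-∷ʳ pre (a ∷ αs) pre⊆𝒵 (a∈𝒵 ∷ αs⊆𝒵) η∉𝒵 (a-sep , αs-indep) =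
    a-sep , IndepAfter-∷ʳ (a ∷ pre) αs (a∈𝒵 ∷ pre⊆𝒵) αs⊆𝒵 η∉𝒵 αs-indep

  ZIndepSet⇒enumeration : ∀ {𝒜} → ZIndepSet 𝒜 → ∃ λ αs → Enumerates 𝒜 αs × IndepAfter [] αs
  ZIndepSet⇒enumeration (empty 𝒜-empty) =
    [] , ([] , λ x → mk⇔ (λ x∈𝒜 → ⊥-elim (𝒜-empty x x∈𝒜)) (λ ())) , tt
  ZIndepSet⇒enumeration (shift S ψ e) with ZIndepSet⇒enumeration S
  ... | αs , αs-enum , αs-indep =
    map (ψ +_) αs , map-enumerates (ψ +_) (∙-cancelˡ ψ _ _) αs-enum e ,
    IndepAfter-shift ψ [] αs αs-indep
  ZIndepSet⇒enumeration (add S S⊆𝒵 η η∉𝒵 e) with ZIndepSet⇒enumeration S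
  ... | αs , αs-enum@(_ , 𝒜⇔αs) , αs-indep =
    αs ∷ʳ η , ∷ʳ-enumerates αs-enum (λ η∈𝒜 → η∉𝒵 (S⊆𝒵 η∈𝒜)) e ,
    IndepAfter-∷ʳ [] αs [] (All.tabulate λ {x} x∈αs → S⊆𝒵 (from (𝒜⇔αs x) x∈αs)) η∉𝒵 αs-indep

  ZIndepSet-∷ : ∀ {pre a} → ZIndepSet (_∈ pre) → Separated pre a → ZIndepSet (_∈ a ∷ pre)
  ZIndepSet-∷ {pre} {a} S (ψ , ψa∉𝒵 , ψpre∈𝒵) =
    shift (add {𝒜 = ψ+pre} (shift S ψ λ _ → ⇔-id _) ψ+pre⊆𝒵 (ψ + a) ψa∉𝒵 λ _ → ⇔-id _)
          (- ψ) λ _ → mk⇔ ⊆back back⊆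
    where
    ψ+pre : Pred K 0ℓ
    ψ+pre x = ∃ λ b → b ∈ pre × x ≡ ψ + b
    ψ+pre⊆𝒵 : ∀ {x} → ψ+pre x → 𝒵 x
    ψ+pre⊆𝒵 (b , b∈pre , refl) = All.lookup ψpre∈𝒵 b∈pre
    ⊆back : ∀ {x} → x ∈ a ∷ pre → ∃ λ y → (ψ+pre y ⊎ y ≡ ψ + a) × x ≡ (- ψ) + y
    ⊆back     (here refl)   = ψ + a , inj₂ refl , sym (-x+[x+y]≡y ψ a)
    ⊆back {x} (there x∈pre) = ψ + x , inj₁ (x , x∈pre , refl) , sym (-x+[x+y]≡y ψ x)
    back⊆ : ∀ {x} → (∃ λ y → (ψ+pre y ⊎ y ≡ ψ + a) × x ≡ (- ψ) + y) → x ∈ a ∷ pre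
    back⊆ (_ , inj₁ (b , b∈pre , refl) , refl) = there (subst (_∈ pre) (sym (-x+[x+y]≡y ψ b)) b∈pre)
    back⊆ (_ , inj₂ refl , refl)              = here (-x+[x+y]≡y ψ a)

  ZIndepSet-reverseAcc : ∀ pre αs → ZIndepSet (_∈ pre) → IndepAfter pre αs →
                         ZIndepSet (_∈ reverseAcc pre αs)
  ZIndepSet-reverseAcc pre []       S _                  = S
  ZIndepSet-reverseAcc pre (a ∷ αs) S (a-sep , αs-indep) =
    ZIndepSet-reverseAcc (a ∷ pre) αs (ZIndepSet-∷ S a-sep) αs-indep

  enumeration⇒ZIndepSet : ∀ {𝒜} αs → (∀ x → 𝒜 x ⇔ x ∈ αs) → IndepAfter [] αs → ZIndepSet 𝒜
  enumeration⇒ZIndepSet αs 𝒜⇔αs αs-indep =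
    ZIndepSet-resp-⇔ (ZIndepSet-reverseAcc [] αs (empty λ _ ()) αs-indep)
      λ x → ⇔-sym (𝒜⇔αs x) ⇔-∘ mk⇔ reverse⁻ reverse⁺

mainTheorem6 : (K : Set) (_+_ : K → K → K) (0# : K) (-_ : K → K) →
    IsAbelianGroup _≡_ _+_ 0# -_ → IsFinite K →
    (𝒵 : Pred K 0ℓ) → (∃ λ x → ¬ 𝒵 x) →
    (𝒜 : Pred K 0ℓ) →
    ZIndependence.ZIndepSet _+_ 𝒵 𝒜 ⇔
      (Σ (List K) λ αs → Unique αs × (∀ x → 𝒜 x ⇔ x ∈ αs) ×
        ZIndependence.ZIndepSeq _+_ 𝒵 αs)
mainTheorem6 K _+_ 0# -_ isAbelianGroup _ 𝒵 _ 𝒜 = mk⇔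
  (λ S → let αs , (αs-unique , 𝒜⇔αs) , αs-indep = ZIndepSet⇒enumeration isGroup 𝒵 S
         in αs , αs-unique , 𝒜⇔αs , from (ZIndepSeq⇔IndepAfter[] isGroup 𝒵 αs) αs-indep)
  (λ (αs , _ , 𝒜⇔αs , αs-seq) →
     enumeration⇒ZIndepSet isGroup 𝒵 αs 𝒜⇔αs (to (ZIndepSeq⇔IndepAfter[] isGroup 𝒵 αs) αs-seq))
  where open IsAbelianGroup isAbelianGroup using (isGroup)
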